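{- For all integers $m,n,k\ge0$, $$\left\{ {m+n}\atop k\right\}=\sum_i(-t)^{i(i-k)}X^{mi}Y^{n(k-i)}\left\{ m\atop {k-i}\right\}\left\{ n\atop i\right\},$$ where the sum is over all integers $i$ and a Fibonomial $\left\{ a\atop b\right\}$ is interpreted as $0$ unless $0\le b\le a$.
   Context: Let $s,t$ be indeterminates. The generalized Fibonacci polynomials are $\{0\}=0$, $\{1\}=1$, $\{n\}=s\{n-1\}+t\{n-2\}$ for $n\ge2$; $\{n\}!=\{1\}\cdots\{n\}$ (with $\{0\}!=1$), and $\left\{ n\atop k\right\}=\frac{\{n\}!}{\{k\}!\{n-k\}!}$ for $0\le k\le n$. $X=\frac{s+\sqrt{s^2+4t}}{2}$ and $Y=\frac{s-\sqrt{s^2+4t}}{2}$, so $X+Y=s$, $XY=-t$. -}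

module Defs where

open import Level using (Level; _⊔_) renaming (suc to lsuc)
open import Algebra.Bundles using (CommutativeRing)
open import Relation.Nullary using (¬_; yes; no)
open import Data.Nat as ℕ using (ℕ; zero; suc; _∸_; _≤?_)
open import Data.Integer as ℤ using (ℤ; +_; -[1+_])

-- A field: a commutative ring with 1 ≉ 0 and a (total) inverse operation that
-- is a genuine multiplicative inverse on every nonzero element
-- (the value of 0⁻¹ is irrelevant; x / y is x * y ⁻¹).
record Field (c ℓ : Level) : Set (lsuc (c ⊔ ℓ)) where
  field
    commutativeRing : CommutativeRing c ℓ
  open CommutativeRing commutativeRing public
  infix 8 _⁻¹
  field
    _⁻¹      : Carrier → Carrier
    ⁻¹-cong  : ∀ {x y} → x ≈ y → x ⁻¹ ≈ y ⁻¹
    1≉0      : ¬ (1# ≈ 0#)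
    inverseʳ : ∀ x → ¬ (x ≈ 0#) → x * x ⁻¹ ≈ 1#

module Fibonomial {c ℓ : Level} (F : Field c ℓ) (X Y : Field.Carrier F) where
  open Field F hiding (zero)

  s t : Carrier
  s = X + Y
  t = - (X * Y)

  fib : ℕ → Carrier
  fib zero = 0#
  fib (suc zero) = 1#
  fib (suc (suc n)) = s * fib (suc n) + t * fib n

  fib! : ℕ → Carrier
  fib! zero = 1#
  fib! (suc n) = fib! n * fib (suc n)

  fibonomial : ℕ → ℕ → Carrier
  fibonomial a b with b ≤? a
  ... | yes _ = fib! a * (fib! b * fib! (a ∸ b)) ⁻¹
  ... | no  _ = 0#

  pow : Carrier → ℕ → Carrier
  pow x zero = 1#
  pow x (suc n) = x * pow x n

  zpow : Carrier → ℤ → Carrier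
  zpow x (+ n) = pow x n
  zpow x -[1+ n ] = (pow x (suc n)) ⁻¹

  sumUpTo : ℕ → (ℕ → Carrier) → Carrier
  sumUpTo zero f = f zero
  sumUpTo (suc k) f = sumUpTo k f + f (suc k)

  -- the i-th summand (-t)^{i(i-k)} X^{m i} Y^{n (k-i)} {m choose k-i} {n choose i},
  -- for 0 ≤ i ≤ k (all other integers i give a zero summand)
  summand : ℕ → ℕ → ℕ → ℕ → Carrier
  summand m n k i =
    zpow (- t) ((+ i) ℤ.* ((+ i) ℤ.- (+ k)))
      * pow X (m ℕ.* i) * pow Y (n ℕ.* (k ∸ i))
      * fibonomial m (k ∸ i) * fibonomial n i

-- The addition law {a + b} = X^b {a} + Y^a {b} gives {n}! = P(n,k) {k}! {n-k}! for the
-- polynomials P defined by the Pascal-type recurrence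
--   P(n+1,k+1) = Y^(k+1) P(n,k+1) + X^(n-k) P(n,k),
-- so P is the Fibonomial once no {j} vanishes.  Induction on n along this recurrence gives
-- the convolution P(m+n,k) = Σ_i X^(i(m-k+i)) Y^((k-i)(n-i)) P(m,k-i) P(n,i), and since
-- -t = XY the paper's weight (-t)^(i(i-k)) X^(mi) Y^(n(k-i)) equals X^(i(m-k+i)) Y^((k-i)(n-i))
-- whenever P(m,k-i) P(n,i) can be nonzero.

module Submission where

open import Defs
open import Level using (Level)
open import Relation.Nullary using (¬_; yes; no)
open import Data.Nat as ℕ using (ℕ; zero; suc; _∸_; _≤_; _<_; s≤s; _≤?_)
import Data.Nat.Properties as ℕ
import Data.Nat.Tactic.RingSolver as ℕ-Solver
open import Data.Integer as ℤ using (+_)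
import Data.Integer.Properties as ℤ
import Data.Integer.Tactic.RingSolver as ℤ-Solver
open import Relation.Binary.PropositionalEquality as ≡ using (_≡_)
import Algebra.Solver.Ring.NaturalCoefficients.Default as NaturalCoefficients
import Algebra.Properties.Ring as RingProperties
import Algebra.Properties.Semiring.Exp as SemiringExp
import Algebra.Properties.CommutativeSemiring.Exp as CommutativeSemiringExp

m+n∸[o+p]≡[m∸o]+[n∸p] : ∀ {m n o p} → o ≤ m → p ≤ n →
                        (m ℕ.+ n) ∸ (o ℕ.+ p) ≡ (m ∸ o) ℕ.+ (n ∸ p)
m+n∸[o+p]≡[m∸o]+[n∸p] {m} {n} {o} {p} o≤m p≤n = begin
  (m ℕ.+ n) ∸ (o ℕ.+ p)  ≡⟨ ℕ.∸-+-assoc (m ℕ.+ n) o p ⟨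
  (m ℕ.+ n) ∸ o ∸ p      ≡⟨ ≡.cong (_∸ p) (ℕ.+-∸-comm n o≤m) ⟩
  (m ∸ o) ℕ.+ n ∸ p      ≡⟨ ℕ.+-∸-assoc (m ∸ o) p≤n ⟩
  (m ∸ o) ℕ.+ (n ∸ p)    ∎
  where open ≡.≡-Reasoning

vandermonde-Y-exponent : ∀ {n k j} → j ≤ k → suc j ≤ n →
                         (k ∸ j) ℕ.* (n ∸ j) ℕ.+ suc j ≡ suc k ℕ.+ (k ∸ j) ℕ.* (n ∸ suc j)
vandermonde-Y-exponent {n} {k} {j} j≤k j<n = begin
  a ℕ.* (n ∸ j) ℕ.+ suc j     ≡⟨ ≡.cong (λ l → a ℕ.* l ℕ.+ suc j) (ℕ.+-∸-assoc 1 j<n) ⟩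
  a ℕ.* suc r ℕ.+ suc j       ≡⟨ shuffle a r j ⟩
  suc (j ℕ.+ a) ℕ.+ a ℕ.* r   ≡⟨ ≡.cong (λ l → suc l ℕ.+ a ℕ.* r) (ℕ.m+[n∸m]≡n j≤k) ⟩
  suc k ℕ.+ a ℕ.* r           ∎
  where
  open ≡.≡-Reasoning
  a = k ∸ j
  r = n ∸ suc j
  shuffle : ∀ a r j → a ℕ.* suc r ℕ.+ suc j ≡ suc (j ℕ.+ a) ℕ.+ a ℕ.* r
  shuffle = ℕ-Solver.solve-∀

vandermonde-X-exponent : ∀ {m n k j} → j ≤ k → k ∸ j ≤ m → j ≤ n →
                         suc j ℕ.* (m ∸ (k ∸ j)) ℕ.+ (n ∸ j) ≡ (m ℕ.+ n) ∸ k ℕ.+ j ℕ.* (m ∸ (k ∸ j))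
vandermonde-X-exponent {m} {n} {k} {j} j≤k a≤m j≤n = begin
  suc j ℕ.* (m ∸ a) ℕ.+ (n ∸ j)
    ≡⟨ regroup j (m ∸ a) (n ∸ j) ⟩
  (m ∸ a) ℕ.+ (n ∸ j) ℕ.+ j ℕ.* (m ∸ a)
    ≡⟨ ≡.cong (ℕ._+ j ℕ.* (m ∸ a)) (m+n∸[o+p]≡[m∸o]+[n∸p] a≤m j≤n) ⟨
  (m ℕ.+ n) ∸ (a ℕ.+ j) ℕ.+ j ℕ.* (m ∸ a)
    ≡⟨ ≡.cong (λ l → (m ℕ.+ n) ∸ l ℕ.+ j ℕ.* (m ∸ a)) (ℕ.m∸n+n≡m j≤k) ⟩
  (m ℕ.+ n) ∸ k ℕ.+ j ℕ.* (m ∸ a) ∎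
  where
  open ≡.≡-Reasoning
  a = k ∸ j
  regroup : ∀ j u v → suc j ℕ.* u ℕ.+ v ≡ u ℕ.+ v ℕ.+ j ℕ.* u
  regroup = ℕ-Solver.solve-∀

i*[i-k]≡-i*[k∸i] : ∀ {i k} → i ≤ k → (+ i) ℤ.* ((+ i) ℤ.- (+ k)) ≡ ℤ.- (+ (i ℕ.* (k ∸ i)))
i*[i-k]≡-i*[k∸i] {i} {k} i≤k = begin
  + i ℤ.* (+ i ℤ.- + k)                ≡⟨ ≡.cong (λ l → + i ℤ.* (+ i ℤ.- + l)) (ℕ.m+[n∸m]≡n i≤k) ⟨
  + i ℤ.* (+ i ℤ.- + (i ℕ.+ a))        ≡⟨ ≡.cong (λ l → + i ℤ.* (+ i ℤ.- l)) (ℤ.pos-+ i a) ⟩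
  + i ℤ.* (+ i ℤ.- (+ i ℤ.+ + a))      ≡⟨ x*[x-[x+y]]≡-[x*y] (+ i) (+ a) ⟩
  ℤ.- (+ i ℤ.* + a)                    ≡⟨ ≡.cong ℤ.-_ (ℤ.pos-* i a) ⟨
  ℤ.- (+ (i ℕ.* a))                    ∎
  where
  open ≡.≡-Reasoning
  a = k ∸ i
  x*[x-[x+y]]≡-[x*y] : ∀ x y → x ℤ.* (x ℤ.- (x ℤ.+ y)) ≡ ℤ.- (x ℤ.* y)
  x*[x-[x+y]]≡-[x*y] = ℤ-Solver.solve-∀

module _ {c ℓ : Level} (F : Field c ℓ) (X Y : Field.Carrier F) where
  open Field F hiding (zero)
  open Fibonomial F X Y
  open RingProperties ring using (-‿involutive; -0#≈0#)
  open SemiringExp semiring using (_^_; ^-congˡ; ^-homo-*)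
  open CommutativeSemiringExp commutativeSemiring using (^-distrib-*)
  open NaturalCoefficients commutativeSemiring using (solve; _:=_; _:+_; _:*_)
  open import Relation.Binary.Reasoning.Setoid setoid

  x≈0⇒x*y≈0 : ∀ {x y} → x ≈ 0# → x * y ≈ 0#
  x≈0⇒x*y≈0 {y = y} x≈0 = trans (*-congʳ x≈0) (zeroˡ y)

  y≈0⇒x*y≈0 : ∀ {x y} → y ≈ 0# → x * y ≈ 0#
  y≈0⇒x*y≈0 {x} y≈0 = trans (*-congˡ y≈0) (zeroʳ x)

  x≉0∧y≉0⇒x*y≉0 : ∀ {x y} → ¬ x ≈ 0# → ¬ y ≈ 0# → ¬ x * y ≈ 0#
  x≉0∧y≉0⇒x*y≉0 {x} {y} x≉0 y≉0 x*y≈0 = x≉0 (begin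
    x              ≈⟨ *-identityʳ x ⟨
    x * 1#         ≈⟨ *-congˡ (inverseʳ y y≉0) ⟨
    x * (y * y ⁻¹) ≈⟨ *-assoc x y (y ⁻¹) ⟨
    x * y * y ⁻¹   ≈⟨ x≈0⇒x*y≈0 x*y≈0 ⟩
    0#             ∎)

  x≉0⇒-x≉0 : ∀ {x} → ¬ x ≈ 0# → ¬ - x ≈ 0#
  x≉0⇒-x≉0 {x} x≉0 -x≈0 = x≉0 (trans (sym (-‿involutive x)) (trans (-‿cong -x≈0) -0#≈0#))

  pow≡^ : ∀ x n → pow x n ≡ x ^ n
  pow≡^ x zero    = ≡.refl
  pow≡^ x (suc n) = ≡.cong (x *_) (pow≡^ x n)

  pow-congˡ : ∀ n {x y} → x ≈ y → pow x n ≈ pow y n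
  pow-congˡ n {x} {y} x≈y = begin
    pow x n ≡⟨ pow≡^ x n ⟩
    x ^ n   ≈⟨ ^-congˡ n x≈y ⟩
    y ^ n   ≡⟨ pow≡^ y n ⟨
    pow y n ∎

  pow-+ : ∀ x a b → pow x (a ℕ.+ b) ≈ pow x a * pow x b
  pow-+ x a b = begin
    pow x (a ℕ.+ b)   ≡⟨ pow≡^ x (a ℕ.+ b) ⟩
    x ^ (a ℕ.+ b)     ≈⟨ ^-homo-* x a b ⟩
    x ^ a * x ^ b     ≡⟨ ≡.cong₂ _*_ (pow≡^ x a) (pow≡^ x b) ⟨
    pow x a * pow x b ∎

  pow-distrib-* : ∀ x y n → pow (x * y) n ≈ pow x n * pow y n
  pow-distrib-* x y n = begin
    pow (x * y) n     ≡⟨ pow≡^ (x * y) n ⟩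
    (x * y) ^ n       ≈⟨ ^-distrib-* x y n ⟩
    x ^ n * y ^ n     ≡⟨ ≡.cong₂ _*_ (pow≡^ x n) (pow≡^ y n) ⟨
    pow x n * pow y n ∎

  pow-split : ∀ x a b {n} → n ≡ a ℕ.+ b → pow x n ≈ pow x a * pow x b
  pow-split x a b ≡.refl = pow-+ x a b

  pow-exchange : ∀ x a b a′ b′ → a ℕ.+ b ≡ a′ ℕ.+ b′ → pow x a * pow x b ≈ pow x a′ * pow x b′
  pow-exchange x a b a′ b′ eq = trans (sym (pow-+ x a b)) (pow-split x a′ b′ eq)

  pow≉0 : ∀ {x} → ¬ x ≈ 0# → ∀ n → ¬ pow x n ≈ 0#
  pow≉0 x≉0 zero    = 1≉0
  pow≉0 x≉0 (suc n) = x≉0∧y≉0⇒x*y≉0 x≉0 (pow≉0 x≉0 n)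

  zpow-neg*pow : ∀ {x} → ¬ x ≈ 0# → ∀ n → zpow x (ℤ.- (+ n)) * pow x n ≈ 1#
  zpow-neg*pow x≉0 zero        = *-identityˡ 1#
  zpow-neg*pow {x} x≉0 (suc n) = trans (*-comm _ _) (inverseʳ (pow x (suc n)) (pow≉0 x≉0 (suc n)))

  sumUpTo-cong : ∀ k {f g : ℕ → Carrier} → (∀ i → i ≤ k → f i ≈ g i) → sumUpTo k f ≈ sumUpTo k g
  sumUpTo-cong zero    f≈g = f≈g 0 ℕ.z≤n
  sumUpTo-cong (suc k) f≈g =
    +-cong (sumUpTo-cong k (λ i i≤k → f≈g i (ℕ.m≤n⇒m≤1+n i≤k))) (f≈g (suc k) ℕ.≤-refl)

  sumUpTo-head : ∀ k {f : ℕ → Carrier} → (∀ i → f (suc i) ≈ 0#) → sumUpTo k f ≈ f 0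
  sumUpTo-head zero    f≈0 = refl
  sumUpTo-head (suc k) f≈0 = trans (+-cong (sumUpTo-head k f≈0) (f≈0 k)) (+-identityʳ _)

  sumUpTo-pascal : ∀ k {f g h : ℕ → Carrier} a b → f 0 ≈ a * g 0 →
                   (∀ j → j ≤ k → f (suc j) ≈ a * g (suc j) + b * h j) →
                   sumUpTo (suc k) f ≈ a * sumUpTo (suc k) g + b * sumUpTo k h
  sumUpTo-pascal zero {f} {g} {h} a b head step = begin
    f 0 + f 1
      ≈⟨ +-cong head (step 0 ℕ.z≤n) ⟩
    a * g 0 + (a * g 1 + b * h 0)
      ≈⟨ solve 5 (λ a b g₀ g₁ h₀ → a :* g₀ :+ (a :* g₁ :+ b :* h₀) := a :* (g₀ :+ g₁) :+ b :* h₀)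
                 refl a b (g 0) (g 1) (h 0) ⟩
    a * (g 0 + g 1) + b * h 0 ∎
  sumUpTo-pascal (suc k) {f} {g} {h} a b head step = begin
    sumUpTo (suc k) f + f (suc (suc k))
      ≈⟨ +-cong (sumUpTo-pascal k a b head (λ j j≤k → step j (ℕ.m≤n⇒m≤1+n j≤k)))
                (step (suc k) ℕ.≤-refl) ⟩
    a * G + b * H + (a * g (suc (suc k)) + b * h (suc k))
      ≈⟨ solve 6 (λ a b G H g′ h′ →
                      a :* G :+ b :* H :+ (a :* g′ :+ b :* h′)
                   := a :* (G :+ g′) :+ b :* (H :+ h′))
                 refl a b G H (g (suc (suc k))) (h (suc k)) ⟩
    a * (G + g (suc (suc k))) + b * (H + h (suc k)) ∎
    where
    G = sumUpTo (suc k) g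
    H = sumUpTo k h

  fib-suc : ∀ n → fib (suc n) ≈ X * fib n + pow Y n
  fib-suc zero    = sym (trans (+-congʳ (zeroʳ X)) (+-identityˡ 1#))
  fib-suc (suc n) = begin
    (X + Y) * fib (suc n) + t * fib n
      ≈⟨ solve 5 (λ x y g f p → (x :+ y) :* g :+ p :* f := x :* g :+ y :* g :+ p :* f)
                 refl X Y (fib (suc n)) (fib n) t ⟩
    X * fib (suc n) + Y * fib (suc n) + t * fib n
      ≈⟨ +-congʳ (+-congˡ (*-congˡ (fib-suc n))) ⟩
    X * fib (suc n) + Y * (X * fib n + pow Y n) + t * fib n
      ≈⟨ solve 6 (λ x y g f p w →
                      x :* g :+ y :* (x :* f :+ p) :+ w :* f
                   := x :* g :+ y :* p :+ (x :* y :+ w) :* f)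
                 refl X Y (fib (suc n)) (fib n) (pow Y n) t ⟩
    X * fib (suc n) + pow Y (suc n) + (X * Y + t) * fib n
      ≈⟨ +-congˡ (x≈0⇒x*y≈0 (-‿inverseʳ (X * Y))) ⟩
    X * fib (suc n) + pow Y (suc n) + 0#
      ≈⟨ +-identityʳ _ ⟩
    X * fib (suc n) + pow Y (suc n) ∎

  fib-+ : ∀ a b → fib (a ℕ.+ b) ≈ pow X b * fib a + pow Y a * fib b
  fib-+ a zero rewrite ℕ.+-identityʳ a = sym (trans (+-cong (*-identityˡ _) (zeroʳ _)) (+-identityʳ _))
  fib-+ a (suc b) rewrite ℕ.+-suc a b = begin
    fib (suc (a ℕ.+ b))
      ≈⟨ fib-suc (a ℕ.+ b) ⟩
    X * fib (a ℕ.+ b) + pow Y (a ℕ.+ b)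
      ≈⟨ +-cong (*-congˡ (fib-+ a b)) (pow-+ Y a b) ⟩
    X * (pow X b * fib a + pow Y a * fib b) + pow Y a * pow Y b
      ≈⟨ solve 6 (λ x xᵇ fa yᵃ fb yᵇ →
                      x :* (xᵇ :* fa :+ yᵃ :* fb) :+ yᵃ :* yᵇ
                   := x :* xᵇ :* fa :+ yᵃ :* (x :* fb :+ yᵇ))
                 refl X (pow X b) (fib a) (pow Y a) (fib b) (pow Y b) ⟩
    pow X (suc b) * fib a + pow Y a * (X * fib b + pow Y b)
      ≈⟨ +-congˡ (*-congˡ (fib-suc b)) ⟨
    pow X (suc b) * fib a + pow Y a * fib (suc b) ∎

  pascal : ℕ → ℕ → Carrier
  pascal n       zero    = 1#
  pascal zero    (suc k) = 0#
  pascal (suc n) (suc k) = pow Y (suc k) * pascal n (suc k) + pow X (n ∸ k) * pascal n k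

  pascal-over : ∀ {n k} → n < k → pascal n k ≈ 0#
  pascal-over {zero}  {suc k} _         = refl
  pascal-over {suc n} {suc k} (s≤s n<k) =
    trans (+-cong (y≈0⇒x*y≈0 (pascal-over (ℕ.m<n⇒m<1+n n<k))) (y≈0⇒x*y≈0 (pascal-over n<k)))
          (+-identityʳ 0#)

  pascal-diag : ∀ n → pascal n n ≈ 1#
  pascal-diag zero    = refl
  pascal-diag (suc n) = begin
    pow Y (suc n) * pascal n (suc n) + pow X (n ∸ n) * pascal n n
      ≈⟨ +-cong (y≈0⇒x*y≈0 (pascal-over {n} ℕ.≤-refl))
                (*-cong (reflexive (≡.cong (pow X) (ℕ.n∸n≡0 n))) (pascal-diag n)) ⟩
    0# + 1# * 1#
      ≈⟨ trans (+-identityˡ _) (*-identityˡ 1#) ⟩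
    1# ∎

  fib!-factor : ∀ k e → fib! (k ℕ.+ e) ≈ pascal (k ℕ.+ e) k * (fib! k * fib! e)
  fib!-factor zero    e = sym (trans (*-identityˡ _) (*-identityˡ _))
  fib!-factor (suc k) zero rewrite ℕ.+-identityʳ k = begin
    fib! (suc k)                                   ≈⟨ *-identityˡ _ ⟨
    1# * fib! (suc k)                              ≈⟨ *-cong (pascal-diag (suc k)) (*-identityʳ _) ⟨
    pascal (suc k) (suc k) * (fib! (suc k) * 1#)   ∎
  fib!-factor (suc k) (suc e) = begin
    fib! n * fib (suc k ℕ.+ suc e)
      ≈⟨ *-congˡ (fib-+ (suc k) (suc e)) ⟩
    fib! n * (xᵉ * fib (suc k) + yᵏ * fib (suc e))
      ≈⟨ distribˡ (fib! n) _ _ ⟩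
    fib! n * (xᵉ * fib (suc k)) + fib! n * (yᵏ * fib (suc e))
      ≈⟨ +-cong (*-congʳ (fib!-factor k (suc e))) (*-congʳ fib!-factor-suc) ⟩
    pascal n k * (fib! k * fib! (suc e)) * (xᵉ * fib (suc k))
      + pascal n (suc k) * (fib! (suc k) * fib! e) * (yᵏ * fib (suc e))
      ≈⟨ solve 8 (λ p p′ f!k fk f!e fe xᵉ yᵏ →
                      p :* (f!k :* (f!e :* fe)) :* (xᵉ :* fk) :+ p′ :* (f!k :* fk :* f!e) :* (yᵏ :* fe)
                   := (yᵏ :* p′ :+ xᵉ :* p) :* (f!k :* fk :* (f!e :* fe)))
                 refl (pascal n k) (pascal n (suc k)) (fib! k) (fib (suc k))
                      (fib! e) (fib (suc e)) xᵉ yᵏ ⟩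
    (yᵏ * pascal n (suc k) + xᵉ * pascal n k) * (fib! (suc k) * fib! (suc e))
      ≡⟨ ≡.cong (λ l → (yᵏ * pascal n (suc k) + pow X l * pascal n k) * (fib! (suc k) * fib! (suc e)))
                (ℕ.m+n∸m≡n k (suc e)) ⟨
    pascal (suc n) (suc k) * (fib! (suc k) * fib! (suc e)) ∎
    where
    n  = k ℕ.+ suc e
    xᵉ = pow X (suc e)
    yᵏ = pow Y (suc k)
    fib!-factor-suc : fib! n ≈ pascal n (suc k) * (fib! (suc k) * fib! e)
    fib!-factor-suc = ≡.subst (λ l → fib! l ≈ pascal l (suc k) * (fib! (suc k) * fib! e))
                              (≡.sym (ℕ.+-suc k e)) (fib!-factor (suc k) e)

  fib!≉0 : (∀ j → ¬ fib (suc j) ≈ 0#) → ∀ n → ¬ fib! n ≈ 0#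
  fib!≉0 fib≉0 zero    = 1≉0
  fib!≉0 fib≉0 (suc n) = x≉0∧y≉0⇒x*y≉0 (fib!≉0 fib≉0 n) (fib≉0 n)

  fibonomial≈pascal : (∀ j → ¬ fib (suc j) ≈ 0#) → ∀ a b → fibonomial a b ≈ pascal a b
  fibonomial≈pascal fib≉0 a b with b ≤? a
  ... | no  b≰a = sym (pascal-over (ℕ.≰⇒> b≰a))
  ... | yes b≤a = begin
    fib! a * d ⁻¹           ≈⟨ *-congʳ fib!-factor′ ⟩
    pascal a b * d * d ⁻¹   ≈⟨ *-assoc _ _ _ ⟩
    pascal a b * (d * d ⁻¹) ≈⟨ *-congˡ (inverseʳ d d≉0) ⟩
    pascal a b * 1#         ≈⟨ *-identityʳ _ ⟩
    pascal a b              ∎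
    where
    d = fib! b * fib! (a ∸ b)
    d≉0 : ¬ d ≈ 0#
    d≉0 = x≉0∧y≉0⇒x*y≉0 (fib!≉0 fib≉0 b) (fib!≉0 fib≉0 (a ∸ b))
    fib!-factor′ : fib! a ≈ pascal a b * d
    fib!-factor′ = ≡.subst (λ l → fib! l ≈ pascal l b * d) (ℕ.m+[n∸m]≡n b≤a) (fib!-factor b (a ∸ b))

  *-congʳ-pascal : ∀ n i {x y} → (i ≤ n → x ≈ y) → x * pascal n i ≈ y * pascal n i
  *-congʳ-pascal n i x≈y with i ≤? n
  ... | yes i≤n = *-congʳ (x≈y i≤n)
  ... | no  i≰n = trans (y≈0⇒x*y≈0 pascal≈0) (sym (y≈0⇒x*y≈0 pascal≈0))
    where pascal≈0 = pascal-over (ℕ.≰⇒> i≰n)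

  *-congʳ-pascal² : ∀ m n a i {x y} → (a ≤ m → i ≤ n → x ≈ y) →
                    x * pascal m a * pascal n i ≈ y * pascal m a * pascal n i
  *-congʳ-pascal² m n a i x≈y = *-congʳ-pascal n i (λ i≤n → *-congʳ-pascal m a (λ a≤m → x≈y a≤m i≤n))

  -- The truncated subtractions are harmless: out of range a pascal factor vanishes.
  vandermondeTerm : ℕ → ℕ → ℕ → ℕ → Carrier
  vandermondeTerm m n k i =
    pow X (i ℕ.* (m ∸ (k ∸ i))) * pow Y ((k ∸ i) ℕ.* (n ∸ i)) * pascal m (k ∸ i) * pascal n i

  vandermondeTerm-head : ∀ m n k →
    vandermondeTerm m (suc n) (suc k) 0 ≈ pow Y (suc k) * vandermondeTerm m n (suc k) 0
  vandermondeTerm-head m n k = begin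
    1# * pow Y (suc k ℕ.* suc n) * pascal m (suc k) * 1#
      ≈⟨ *-congʳ (*-congʳ (*-congˡ (pow-split Y (suc k) (suc k ℕ.* n) (ℕ.*-suc (suc k) n)))) ⟩
    1# * (pow Y (suc k) * pow Y (suc k ℕ.* n)) * pascal m (suc k) * 1#
      ≈⟨ solve 4 (λ o yᵏ y′ p → o :* (yᵏ :* y′) :* p :* o := yᵏ :* (o :* y′ :* p :* o))
                 refl 1# (pow Y (suc k)) (pow Y (suc k ℕ.* n)) (pascal m (suc k)) ⟩
    pow Y (suc k) * (1# * pow Y (suc k ℕ.* n) * pascal m (suc k) * 1#) ∎

  vandermondeTerm-pascal : ∀ m n k j → j ≤ k →
    vandermondeTerm m (suc n) (suc k) (suc j)
      ≈ pow Y (suc k) * vandermondeTerm m n (suc k) (suc j)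
        + pow X ((m ℕ.+ n) ∸ k) * vandermondeTerm m n k j
  vandermondeTerm-pascal m n k j j≤k = begin
    xᴬ * yᴮ * p * (pow Y (suc j) * q₁ + pow X (n ∸ j) * q₀)
      ≈⟨ solve 7 (λ xᴬ yᴮ p yʲ q₁ xⁿ q₀ → xᴬ :* yᴮ :* p :* (yʲ :* q₁ :+ xⁿ :* q₀)
                                        := xᴬ :* p :* (yᴮ :* yʲ) :* q₁ :+ xᴬ :* xⁿ :* yᴮ :* p :* q₀)
                 refl xᴬ yᴮ p (pow Y (suc j)) q₁ (pow X (n ∸ j)) q₀ ⟩
    xᴬ * p * (yᴮ * pow Y (suc j)) * q₁ + xᴬ * pow X (n ∸ j) * yᴮ * p * q₀
      ≈⟨ +-cong (*-congʳ-pascal n (suc j) (λ j<n → *-congˡ (Y-powers j<n)))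
                (*-congʳ-pascal² m n a j (λ a≤m j≤n → *-congʳ (X-powers a≤m j≤n))) ⟩
    xᴬ * p * (pow Y (suc k) * yᴮ′) * q₁ + pow X ((m ℕ.+ n) ∸ k) * xᴬ′ * yᴮ * p * q₀
      ≈⟨ solve 9 (λ xᴬ xᴬ′ yᴮ yᴮ′ p q₁ q₀ yᵏ xᵐ →
                      xᴬ :* p :* (yᵏ :* yᴮ′) :* q₁ :+ xᵐ :* xᴬ′ :* yᴮ :* p :* q₀
                   := yᵏ :* (xᴬ :* yᴮ′ :* p :* q₁) :+ xᵐ :* (xᴬ′ :* yᴮ :* p :* q₀))
                 refl xᴬ xᴬ′ yᴮ yᴮ′ p q₁ q₀ (pow Y (suc k)) (pow X ((m ℕ.+ n) ∸ k)) ⟩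
    pow Y (suc k) * (xᴬ * yᴮ′ * p * q₁) + pow X ((m ℕ.+ n) ∸ k) * (xᴬ′ * yᴮ * p * q₀) ∎
    where
    a   = k ∸ j
    xᴬ  = pow X (suc j ℕ.* (m ∸ a))
    xᴬ′ = pow X (j ℕ.* (m ∸ a))
    yᴮ  = pow Y (a ℕ.* (n ∸ j))
    yᴮ′ = pow Y (a ℕ.* (n ∸ suc j))
    p   = pascal m a
    q₁  = pascal n (suc j)
    q₀  = pascal n j

    Y-powers : suc j ≤ n → yᴮ * pow Y (suc j) ≈ pow Y (suc k) * yᴮ′
    Y-powers j<n = pow-exchange Y (a ℕ.* (n ∸ j)) (suc j) (suc k) (a ℕ.* (n ∸ suc j))
                                (vandermonde-Y-exponent j≤k j<n)

    X-powers : a ≤ m → j ≤ n → xᴬ * pow X (n ∸ j) ≈ pow X ((m ℕ.+ n) ∸ k) * xᴬ′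
    X-powers a≤m j≤n = pow-exchange X (suc j ℕ.* (m ∸ a)) (n ∸ j) ((m ℕ.+ n) ∸ k) (j ℕ.* (m ∸ a))
                                    (vandermonde-X-exponent j≤k a≤m j≤n)

  vandermonde : ∀ m n k → sumUpTo k (vandermondeTerm m n k) ≈ pascal (m ℕ.+ n) k
  vandermonde m n       zero    = trans (*-identityʳ _) (trans (*-identityʳ _) (*-identityʳ 1#))
  vandermonde m zero    (suc k) rewrite ℕ.+-identityʳ m = begin
    sumUpTo (suc k) (vandermondeTerm m 0 (suc k))
      ≈⟨ sumUpTo-head (suc k) (λ i → zeroʳ _) ⟩
    1# * pow Y (suc k ℕ.* 0) * pascal m (suc k) * 1#
      ≡⟨ ≡.cong (λ l → 1# * pow Y l * pascal m (suc k) * 1#) (ℕ.*-zeroʳ (suc k)) ⟩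
    1# * 1# * pascal m (suc k) * 1#
      ≈⟨ trans (*-identityʳ _) (trans (*-congʳ (*-identityˡ 1#)) (*-identityˡ _)) ⟩
    pascal m (suc k) ∎
  vandermonde m (suc n) (suc k) rewrite ℕ.+-suc m n = begin
    sumUpTo (suc k) (vandermondeTerm m (suc n) (suc k))
      ≈⟨ sumUpTo-pascal k (pow Y (suc k)) (pow X ((m ℕ.+ n) ∸ k))
                        (vandermondeTerm-head m n k) (vandermondeTerm-pascal m n k) ⟩
    pow Y (suc k) * sumUpTo (suc k) (vandermondeTerm m n (suc k))
      + pow X ((m ℕ.+ n) ∸ k) * sumUpTo k (vandermondeTerm m n k)
      ≈⟨ +-cong (*-congˡ (vandermonde m n (suc k))) (*-congˡ (vandermonde m n k)) ⟩
    pascal (suc (m ℕ.+ n)) (suc k) ∎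

  summand-weight : ¬ t ≈ 0# → ∀ {m n k i} → i ≤ k → k ∸ i ≤ m → i ≤ n →
    zpow (- t) ((+ i) ℤ.* ((+ i) ℤ.- (+ k))) * pow X (m ℕ.* i) * pow Y (n ℕ.* (k ∸ i))
      ≈ pow X (i ℕ.* (m ∸ (k ∸ i))) * pow Y ((k ∸ i) ℕ.* (n ∸ i))
  summand-weight t≉0 {m} {n} {k} {i} i≤k a≤m i≤n = begin
    zpow (- t) ((+ i) ℤ.* ((+ i) ℤ.- (+ k))) * pow X (m ℕ.* i) * pow Y (n ℕ.* a)
      ≡⟨ ≡.cong (λ e → zpow (- t) e * pow X (m ℕ.* i) * pow Y (n ℕ.* a)) (i*[i-k]≡-i*[k∸i] i≤k) ⟩
    z * pow X (m ℕ.* i) * pow Y (n ℕ.* a)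
      ≈⟨ *-cong (*-congˡ (pow-split X w (i ℕ.* (m ∸ a)) X-exponent))
                (pow-split Y w (a ℕ.* (n ∸ i)) Y-exponent) ⟩
    z * (pow X w * xʳ) * (pow Y w * yʳ)
      ≈⟨ solve 5 (λ z xʷ xʳ yʷ yʳ → z :* (xʷ :* xʳ) :* (yʷ :* yʳ) := z :* (xʷ :* yʷ) :* (xʳ :* yʳ))
                 refl z (pow X w) xʳ (pow Y w) yʳ ⟩
    z * (pow X w * pow Y w) * (xʳ * yʳ)
      ≈⟨ *-congʳ (*-congˡ (trans (sym (pow-distrib-* X Y w))
                                 (pow-congˡ w (sym (-‿involutive (X * Y)))))) ⟩
    z * pow (- t) w * (xʳ * yʳ)
      ≈⟨ *-congʳ (zpow-neg*pow (x≉0⇒-x≉0 t≉0) w) ⟩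
    1# * (xʳ * yʳ)
      ≈⟨ *-identityˡ _ ⟩
    xʳ * yʳ ∎
    where
    a  = k ∸ i
    w  = i ℕ.* a
    z  = zpow (- t) (ℤ.- (+ w))
    xʳ = pow X (i ℕ.* (m ∸ a))
    yʳ = pow Y (a ℕ.* (n ∸ i))
    distrib₁ : ∀ a r i → (a ℕ.+ r) ℕ.* i ≡ i ℕ.* a ℕ.+ i ℕ.* r
    distrib₁ = ℕ-Solver.solve-∀
    distrib₂ : ∀ i r a → (i ℕ.+ r) ℕ.* a ≡ i ℕ.* a ℕ.+ a ℕ.* r
    distrib₂ = ℕ-Solver.solve-∀
    X-exponent : m ℕ.* i ≡ w ℕ.+ i ℕ.* (m ∸ a)
    X-exponent = ≡.trans (≡.cong (ℕ._* i) (≡.sym (ℕ.m+[n∸m]≡n a≤m))) (distrib₁ a (m ∸ a) i)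
    Y-exponent : n ℕ.* a ≡ w ℕ.+ a ℕ.* (n ∸ i)
    Y-exponent = ≡.trans (≡.cong (ℕ._* a) (≡.sym (ℕ.m+[n∸m]≡n i≤n))) (distrib₂ i (n ∸ i) a)

  summand≈vandermondeTerm : ¬ t ≈ 0# → (∀ j → ¬ fib (suc j) ≈ 0#) →
                            ∀ m n k i → i ≤ k → summand m n k i ≈ vandermondeTerm m n k i
  summand≈vandermondeTerm t≉0 fib≉0 m n k i i≤k =
    trans (*-cong (*-congˡ (fibonomial≈pascal fib≉0 m (k ∸ i))) (fibonomial≈pascal fib≉0 n i))
          (*-congʳ-pascal² m n (k ∸ i) i (summand-weight t≉0 i≤k))

open import Data.Nat using (_+_)

theorem5p5 : ∀ {c ℓ : Level} (F : Field c ℓ) (X Y : Field.Carrier F) →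
    let open Field F hiding (_+_)
        open Fibonomial F X Y
    in ¬ (t ≈ 0#) → (∀ j → ¬ (fib (suc j) ≈ 0#)) →
       ∀ (m n k : ℕ) → fibonomial (m + n) k ≈ sumUpTo k (summand m n k)
theorem5p5 F X Y t≉0 fib≉0 m n k = begin
  fibonomial (m + n) k
    ≈⟨ fibonomial≈pascal F X Y fib≉0 (m + n) k ⟩
  pascal F X Y (m + n) k
    ≈⟨ vandermonde F X Y m n k ⟨
  sumUpTo k (vandermondeTerm F X Y m n k)
    ≈⟨ sumUpTo-cong F X Y k (summand≈vandermondeTerm F X Y t≉0 fib≉0 m n k) ⟨
  sumUpTo k (summand m n k) ∎
  where
  open Field F using (setoid)
  open Fibonomial F X Y
  open import Relation.Binary.Reasoning.Setoid setoid
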